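{- If $G$ is a graph with a unique maximum open packing $U(G)$, then every leaf of $G$ belongs to $U(G)$.
   Context: An open packing in a graph is a set of vertices whose open neighborhoods are pairwise disjoint; a maximum open packing is one of maximum cardinality. A leaf is a vertex of degree 1. -}

module Defs where

open import Data.Nat using (ℕ; _≤_)
open import Data.Fin using (Fin)
open import Data.Fin.Subset using (Subset; _∈_; ∣_∣)
open import Data.Vec using (tabulate)
open import Data.Product using (Σ; _×_; ∃)
open import Relation.Nullary using (¬_; Dec; does)
open import Relation.Binary.PropositionalEquality using (_≡_)

record Graph (n : ℕ) : Set₁ where
  field
    Adj     : Fin n → Fin n → Set
    adj?    : ∀ u v → Dec (Adj u v)
    sym     : ∀ {u v} → Adj u v → Adj v u
    irrefl  : ∀ {u} → ¬ Adj u u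

module _ {n : ℕ} (G : Graph n) where
  open Graph G

  N : Fin n → Subset n
  N v = tabulate (λ w → does (adj? v w))

  degree : Fin n → ℕ
  degree v = ∣ N v ∣

  IsLeaf : Fin n → Set
  IsLeaf v = degree v ≡ 1

  IsOpenPacking : Subset n → Set
  IsOpenPacking S = ∀ u v → u ∈ S → v ∈ S → ¬ (u ≡ v) →
                    ∀ w → ¬ (w ∈ N u × w ∈ N v)

  IsMaxOpenPacking : Subset n → Set
  IsMaxOpenPacking S = IsOpenPacking S × (∀ T → IsOpenPacking T → ∣ T ∣ ≤ ∣ S ∣)

  IsUniqueMaxOpenPacking : Subset n → Set
  IsUniqueMaxOpenPacking U = IsMaxOpenPacking U × (∀ S → IsMaxOpenPacking S → S ≡ U)

-- Let v be a leaf with unique neighbour u, and suppose v ∉ U.  The key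
-- observation (addLeaf) is that adding v to an open packing S keeps it an
-- open packing as long as no vertex of S has u in its neighbourhood, because
-- N(v) = {u}.  Two cases:
--   * no x ∈ U is adjacent to u: then U ∪ {v} is a strictly larger open
--     packing, contradicting maximality of U;
--   * some x ∈ U is adjacent to u: since U is an open packing, x is the only
--     such vertex, so (U - x) ∪ {v} is an open packing of the same size.  It
--     is therefore maximum, hence equal to U by uniqueness, yet contains v.
module Submission where

open import Defs
open import Data.Nat using (ℕ; suc; pred; _≤_)
open import Data.Nat.Properties using (≤-trans; ≤-reflexive; 1+n≰n)
open import Data.Fin using (Fin; zero; suc; _≟_)
open import Data.Fin.Properties using (any?)
open import Data.Fin.Subset
  using (Subset; _∈_; _∉_; _⊆_; ∣_∣; inside; outside; _∪_; _-_; ⁅_⁆)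
open import Data.Fin.Subset.Properties
  using (_∈?_; x∈p∪q⁻; x∈p∪q⁺; x∈⁅x⁆; x∈⁅y⁆⇒x≡y; ∪-identityʳ; p─⊥≡p; p─q⊆p)
open import Data.Vec using (_∷_; here; there)
open import Data.Product using (Σ; _×_; _,_)
open import Data.Sum using (inj₁; inj₂)
open import Relation.Nullary using (yes; no; contradiction)
open import Relation.Nullary.Decidable using (_×-dec_)
open import Relation.Binary.PropositionalEquality
  using (_≡_; _≢_; refl; sym; trans; cong; subst)

∣p∪⁅x⁆∣≡1+∣p∣ : ∀ {n} (p : Subset n) (x : Fin n) → x ∉ p → ∣ p ∪ ⁅ x ⁆ ∣ ≡ suc ∣ p ∣
∣p∪⁅x⁆∣≡1+∣p∣ (outside ∷ p) zero    _   = cong (λ q → suc ∣ q ∣) (∪-identityʳ p)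
∣p∪⁅x⁆∣≡1+∣p∣ (inside  ∷ p) zero    x∉p = contradiction here x∉p
∣p∪⁅x⁆∣≡1+∣p∣ (outside ∷ p) (suc x) x∉p = ∣p∪⁅x⁆∣≡1+∣p∣ p x (λ x∈p → x∉p (there x∈p))
∣p∪⁅x⁆∣≡1+∣p∣ (inside  ∷ p) (suc x) x∉p =
  cong suc (∣p∪⁅x⁆∣≡1+∣p∣ p x (λ x∈p → x∉p (there x∈p)))

1+∣p-x∣≡∣p∣ : ∀ {n} (p : Subset n) (x : Fin n) → x ∈ p → suc ∣ p - x ∣ ≡ ∣ p ∣
1+∣p-x∣≡∣p∣ (inside  ∷ p) zero    _           = cong (λ q → suc ∣ q ∣) (p─⊥≡p p)
1+∣p-x∣≡∣p∣ (outside ∷ p) (suc x) (there x∈p) = 1+∣p-x∣≡∣p∣ p x x∈p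
1+∣p-x∣≡∣p∣ (inside  ∷ p) (suc x) (there x∈p) = cong suc (1+∣p-x∣≡∣p∣ p x x∈p)

x∉p-x : ∀ {n} (p : Subset n) (x : Fin n) → x ∉ p - x
x∉p-x (_ ∷ p) zero    ()
x∉p-x (_ ∷ p) (suc x) (there x∈p-x) = x∉p-x p x x∈p-x

∈p∪⁅x⁆⇒∈p : ∀ {n} {p : Subset n} {x y : Fin n} → y ∈ p ∪ ⁅ x ⁆ → y ≢ x → y ∈ p
∈p∪⁅x⁆⇒∈p {p = p} {x} y∈ y≢x with x∈p∪q⁻ p ⁅ x ⁆ y∈
... | inj₁ y∈p  = y∈p
... | inj₂ y∈⁅x⁆ = contradiction (x∈⁅y⁆⇒x≡y x y∈⁅x⁆) y≢x

∣p∣≡0⇒x∉p : ∀ {n} (p : Subset n) → ∣ p ∣ ≡ 0 → ∀ x → x ∉ p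
∣p∣≡0⇒x∉p (outside ∷ p) ∣p∣≡0 (suc x) (there x∈p) = ∣p∣≡0⇒x∉p p ∣p∣≡0 x x∈p
∣p∣≡0⇒x∉p (inside  ∷ p) ()    x       x∈p

∣p∣≡1⇒singleton : ∀ {n} (p : Subset n) → ∣ p ∣ ≡ 1 →
                  Σ (Fin n) λ u → u ∈ p × (∀ w → w ∈ p → w ≡ u)
∣p∣≡1⇒singleton (inside ∷ p) ∣p∣≡1 = zero , here , onlyZero
  where
  onlyZero : ∀ w → w ∈ inside ∷ p → w ≡ zero
  onlyZero zero    _           = refl
  onlyZero (suc w) (there w∈p) = contradiction w∈p (∣p∣≡0⇒x∉p p (cong pred ∣p∣≡1) w)
∣p∣≡1⇒singleton (outside ∷ p) ∣p∣≡1 with ∣p∣≡1⇒singleton p ∣p∣≡1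
... | u , u∈p , onlyU = suc u , there u∈p , onlySucU
  where
  onlySucU : ∀ w → w ∈ outside ∷ p → w ≡ suc u
  onlySucU (suc w) (there w∈p) = cong suc (onlyU w w∈p)

module _ {n : ℕ} (G : Graph n) where

  leafNeighbour : ∀ v → IsLeaf G v → Σ (Fin n) λ u → ∀ w → w ∈ N G v → w ≡ u
  leafNeighbour v leaf with ∣p∣≡1⇒singleton (N G v) leaf
  ... | u , _ , onlyU = u , onlyU

  packing-⊆ : ∀ {S T} → T ⊆ S → IsOpenPacking G S → IsOpenPacking G T
  packing-⊆ T⊆S pack a b a∈T b∈T = pack a b (T⊆S a∈T) (T⊆S b∈T)

  addLeaf : ∀ {S v u} → IsOpenPacking G S → (∀ w → w ∈ N G v → w ≡ u) →
            (∀ b → b ∈ S → u ∉ N G b) → IsOpenPacking G (S ∪ ⁅ v ⁆)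
  addLeaf {v = v} pack onlyU free a b a∈ b∈ a≢b w (w∈Na , w∈Nb) with a ≟ v | b ≟ v
  ... | yes refl | yes refl = a≢b refl
  ... | yes refl | no b≢v   =
    free b (∈p∪⁅x⁆⇒∈p b∈ b≢v) (subst (_∈ N G b) (onlyU w w∈Na) w∈Nb)
  ... | no a≢v   | yes refl =
    free a (∈p∪⁅x⁆⇒∈p a∈ a≢v) (subst (_∈ N G a) (onlyU w w∈Nb) w∈Na)
  ... | no a≢v   | no b≢v   =
    pack a b (∈p∪⁅x⁆⇒∈p a∈ a≢v) (∈p∪⁅x⁆⇒∈p b∈ b≢v) a≢b w (w∈Na , w∈Nb)

  privateNeighbour : ∀ {U x u} → IsOpenPacking G U → x ∈ U → u ∈ N G x →
                     ∀ b → b ∈ U - x → u ∉ N G b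
  privateNeighbour {U} {x} pack x∈U u∈Nx b b∈U-x u∈Nb =
    pack b x (p─q⊆p U ⁅ x ⁆ b∈U-x) x∈U b≢x _ (u∈Nb , u∈Nx)
    where
    b≢x : b ≢ x
    b≢x refl = x∉p-x U x b∈U-x

  maximum-by-size : ∀ {U T} → IsMaxOpenPacking G U → IsOpenPacking G T →
                    ∣ U ∣ ≤ ∣ T ∣ → IsMaxOpenPacking G T
  maximum-by-size (_ , max) packT ∣U∣≤∣T∣ = packT , λ S packS → ≤-trans (max S packS) ∣U∣≤∣T∣

mainTheorem10 : ∀ {n : ℕ} (G : Graph n) (U : Subset n) →
    IsUniqueMaxOpenPacking G U →
    ∀ (v : Fin n) → IsLeaf G v → v ∈ U
mainTheorem10 G U (maxU@(pack , max) , unique) v leaf with v ∈? U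
... | yes v∈U = v∈U
... | no v∉U with leafNeighbour G v leaf
... | u , onlyU with any? (λ x → (x ∈? U) ×-dec (u ∈? N G x))
...   | no noNeighbour =
  contradiction (≤-trans (≤-reflexive (sym (∣p∪⁅x⁆∣≡1+∣p∣ U v v∉U))) (max _ enlarged)) 1+n≰n
  where
  enlarged : IsOpenPacking G (U ∪ ⁅ v ⁆)
  enlarged = addLeaf G pack onlyU (λ b b∈U u∈Nb → noNeighbour (b , b∈U , u∈Nb))
...   | yes (x , x∈U , u∈Nx) =
  contradiction (subst (v ∈_) (unique _ swappedMax) v∈swapped) v∉U
  where
  v∉U-x : v ∉ U - x
  v∉U-x v∈ = v∉U (p─q⊆p U ⁅ x ⁆ v∈)
  swapped : IsOpenPacking G ((U - x) ∪ ⁅ v ⁆)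
  swapped = addLeaf G (packing-⊆ G (p─q⊆p U ⁅ x ⁆) pack) onlyU
                    (privateNeighbour G pack x∈U u∈Nx)
  sameSize : ∣ U ∣ ≡ ∣ (U - x) ∪ ⁅ v ⁆ ∣
  sameSize = trans (sym (1+∣p-x∣≡∣p∣ U x x∈U)) (sym (∣p∪⁅x⁆∣≡1+∣p∣ (U - x) v v∉U-x))
  swappedMax : IsMaxOpenPacking G ((U - x) ∪ ⁅ v ⁆)
  swappedMax = maximum-by-size G maxU swapped (≤-reflexive sameSize)
  v∈swapped : v ∈ (U - x) ∪ ⁅ v ⁆
  v∈swapped = x∈p∪q⁺ (inj₂ (x∈⁅x⁆ v))
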